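{- Let $G$ be a finite simple graph with $n$ vertices and $m$ edges, let $v\in V(G)$, and let $k\geq 2$ be an integer. Let $P_k(G,v)$ be the graph obtained from a path $w_1w_2\cdots w_k$ by taking $k$ disjoint copies $G^1,\dotsc,G^k$ of $G$ and identifying the copy of $v$ in $G^i$ with $w_i$, for $i=1,\dotsc,k$. If $(n+m-1)(k-1)$ is even and $P_k(G,v)$ contains exactly $k-1$ subgraphs isomorphic to $P_2(G,v)$, then $P_k(G,v)$ is $P_2(G,v)$-supermagic with supermagic sum $(n+m)[(n+m+1)k+1]+\lceil k/2\rceil$.
   Context: All graphs are finite, undirected and simple. A graph $\Gamma=(V,E)$ admits an $H$-covering if every edge of $\Gamma$ belongs to at least one subgraph of $\Gamma$ isomorphic to $H$. Such a $\Gamma$ is $H$-supermagic if there is a bijection $f:V\cup E\to\{1,\dotsc,|V|+|E|\}$ with $f(V)=\{1,\dotsc,|V|\}$ and a constant $f(H)$ (the supermagic sum) such that $\sum_{u\in V(H')}f(u)+\sum_{e\in E(H')}f(e)=f(H)$ for every subgraph $H'\subseteq\Gamma$ with $H'\cong H$. -}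

module Defs where

open import Data.Nat using (ℕ; zero; suc; _+_; _*_; _<_)
open import Data.Fin using (Fin; zero; suc; toℕ; inject₁; splitAt; remQuot; combine)
open import Data.Bool using (Bool; true; false; if_then_else_)
open import Data.Product using (Σ; ∃; _×_; _,_; proj₁; proj₂)
open import Data.Sum using (_⊎_; inj₁; inj₂; [_,_]′)
open import Relation.Binary.PropositionalEquality using (_≡_; _≢_)
open import Relation.Nullary using (¬_)
open import Function.Bundles using (Bijection; _⤖_)
open import Function.Definitions using (Injective)

record Graph : Set where
  field
    nV   : ℕ
    nE   : ℕ
    ends : Fin nE → Fin nV × Fin nV
open Graph public

SamePair : ∀ {n} → Fin n × Fin n → Fin n × Fin n → Set
SamePair (a , b) (c , d) = (a ≡ c × b ≡ d) ⊎ (a ≡ d × b ≡ c)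

Simple : Graph → Set
Simple G = (∀ e → proj₁ (ends G e) ≢ proj₂ (ends G e))
         × (∀ e e' → SamePair (ends G e) (ends G e') → e ≡ e')

Σfin : (n : ℕ) → (Fin n → ℕ) → ℕ
Σfin zero    f = 0
Σfin (suc n) f = f zero + Σfin n (λ i → f (suc i))

record Subgraph (Γ : Graph) : Set where
  field
    inV    : Fin (nV Γ) → Bool
    inE    : Fin (nE Γ) → Bool
    closed : ∀ e → inE e ≡ true →
             (inV (proj₁ (ends Γ e)) ≡ true) × (inV (proj₂ (ends Γ e)) ≡ true)
open Subgraph public

SameSub : ∀ {Γ} → Subgraph Γ → Subgraph Γ → Set
SameSub S T = (∀ x → inV S x ≡ inV T x) × (∀ e → inE S e ≡ inE T e)

IsoTo : (Γ : Graph) → Subgraph Γ → Graph → Set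
IsoTo Γ S H =
  Σ (Fin (nV H) → Fin (nV Γ)) λ φ →
  Σ (Fin (nE H) → Fin (nE Γ)) λ ψ →
    Injective _≡_ _≡_ φ
  × (∀ x → inV S x ≡ true → ∃ λ y → φ y ≡ x)
  × (∀ y → inV S (φ y) ≡ true)
  × Injective _≡_ _≡_ ψ
  × (∀ e → inE S e ≡ true → ∃ λ d → ψ d ≡ e)
  × (∀ d → inE S (ψ d) ≡ true)
  × (∀ d → SamePair (ends Γ (ψ d))
                    (φ (proj₁ (ends H d)) , φ (proj₂ (ends H d))))

HCovering : Graph → Graph → Set
HCovering Γ H = ∀ e → Σ (Subgraph Γ) λ S → IsoTo Γ S H × (inE S e ≡ true)

Labeling : Graph → Set
Labeling Γ = (Fin (nV Γ) ⊎ Fin (nE Γ)) ⤖ Fin (nV Γ + nE Γ)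

label : ∀ {Γ} → Labeling Γ → Fin (nV Γ) ⊎ Fin (nE Γ) → ℕ
label f z = suc (toℕ (Bijection.to f z))

weight : ∀ {Γ} → Labeling Γ → Subgraph Γ → ℕ
weight {Γ} f S =
    Σfin (nV Γ) (λ x → if inV S x then label {Γ} f (inj₁ x) else 0)
  + Σfin (nE Γ) (λ e → if inE S e then label {Γ} f (inj₂ e) else 0)

SupermagicWithSum : Graph → Graph → ℕ → Set
SupermagicWithSum Γ H c =
  HCovering Γ H ×
  Σ (Labeling Γ) λ f →
      (∀ x → toℕ (Bijection.to f (inj₁ x)) < nV Γ)   -- f(V) = {1,…,|V|}
    × (∀ (S : Subgraph Γ) → IsoTo Γ S H → weight f S ≡ c)

ExactlyIsoSubgraphs : Graph → Graph → ℕ → Set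
ExactlyIsoSubgraphs Γ H t =
  Σ (Fin t → Subgraph Γ) λ L →
      (∀ i → IsoTo Γ (L i) H)
    × (∀ i j → SameSub (L i) (L j) → i ≡ j)
    × (∀ (S : Subgraph Γ) → IsoTo Γ S H → ∃ λ i → SameSub S (L i))

-- Vertex (copy i, vertex x) is combine i x; edge (copy i, edge d) is combine i d
-- (first k·m edges), followed by the k-1 path edges w_{j} w_{j+1}.
Pk : ℕ → (G : Graph) → Fin (nV G) → Graph
Pk zero    G v = record { nV = 0 ; nE = 0 ; ends = λ () }
Pk (suc j) G v = record
  { nV   = suc j * nV G
  ; nE   = suc j * nE G + j
  ; ends = λ e → [ copyE , pathE ]′ (splitAt (suc j * nE G) e)
  }
  where
  copyE : Fin (suc j * nE G) → Fin (suc j * nV G) × Fin (suc j * nV G)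
  copyE e' with remQuot {suc j} (nE G) e'
  ... | (i , d) = combine i (proj₁ (ends G d)) , combine i (proj₂ (ends G d))
  pathE : Fin j → Fin (suc j * nV G) × Fin (suc j * nV G)
  pathE i = combine (inject₁ i) v , combine (suc i) v

-- Index the n + m vertices and edges of G as elements 0, …, N − 1 (vertices first), the copies
-- as G⁰, …, G^(k−1), and the path edges as wᵢwᵢ₊₁ for i < k − 1.  Element e of copy c gets the
-- label e·k + rank(e, c) + 1, where every rank(e, ·) permutes {0, …, k − 1}, and wᵢwᵢ₊₁ gets
-- N·k + pathRank(i) + 1; in particular the vertices receive exactly the labels 1, …, nk.  The
-- blocks Gⁱ ∪ Gⁱ⁺¹ ∪ {wᵢwᵢ₊₁} are k − 1 distinct copies of P₂(G,v), hence by hypothesis all of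
-- them, and the weight of block i depends on i only through the pair sums
-- rank(e, i) + rank(e, i + 1) and through pathRank(i).  Element 0 is ranked by the interleaving
-- 0, h, 1, h + 1, … with h = ⌈k/2⌉, whose pair sums are h + i; the other elements alternate
-- between the reversal and the identity, with pair sums 2k − 3 − 2i and 2i + 1.  Running the
-- path ranks backwards when N is odd and forwards when N is even cancels what is left of i.

module Submission where

open import Defs
open import Data.Bool using (Bool; true; false; if_then_else_)
open import Data.Empty using (⊥-elim)
open import Data.Fin as Fin using (Fin; zero; suc; toℕ; inject₁; fromℕ<; splitAt; join; quotient; remainder; combine; _↑ˡ_; _↑ʳ_)
open import Data.Fin.Properties as Finₚ
  using (toℕ-injective; toℕ<n; toℕ-fromℕ<; toℕ-inject₁; remQuot-combine; combine-remQuot; combine-injective;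
         splitAt-↑ˡ; splitAt-↑ʳ; splitAt⁻¹-↑ˡ; splitAt⁻¹-↑ʳ; join-splitAt; ↑ˡ-injective; any?; punchOut-injective; injective⇒≤)
open import Data.Nat using (ℕ; zero; suc; pred; _+_; _*_; _∸_; _≤_; _<_; ⌊_/2⌋; ⌈_/2⌉; z≤n; s≤s)
open import Data.Nat.Divisibility using (_∣_)
open import Data.Nat.Properties
open import Data.Nat.Tactic.RingSolver using (solve-∀)
open import Data.Product using (∃; _×_; _,_; proj₁; proj₂)
open import Data.Sum using (_⊎_; inj₁; inj₂; [_,_]′)
open import Function using (_∘_)
open import Function.Bundles using (Bijection; _⤖_; mk⤖)
open import Function.Definitions using (Injective)
open import Relation.Binary.PropositionalEquality
open import Relation.Nullary using (yes; no)
open import Algebra.Properties.CommutativeSemigroup +-commutativeSemigroup using (interchange)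

-- Finite sums

Σfin-cong : ∀ n {f g : Fin n → ℕ} → (∀ x → f x ≡ g x) → Σfin n f ≡ Σfin n g
Σfin-cong zero    f≗g = refl
Σfin-cong (suc n) f≗g = cong₂ _+_ (f≗g zero) (Σfin-cong n (λ x → f≗g (suc x)))

Σfin-zero : ∀ n → Σfin n (λ _ → 0) ≡ 0
Σfin-zero zero    = refl
Σfin-zero (suc n) = Σfin-zero n

Σfin-if : ∀ n b (f : Fin n → ℕ) → Σfin n (λ x → if b then f x else 0) ≡ (if b then Σfin n f else 0)
Σfin-if n true  f = refl
Σfin-if n false f = Σfin-zero n

Σfin-split : ∀ a b (f : Fin (a + b) → ℕ) →
             Σfin (a + b) f ≡ Σfin a (λ x → f (x ↑ˡ b)) + Σfin b (λ y → f (a ↑ʳ y))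
Σfin-split zero    b f = refl
Σfin-split (suc a) b f =
  trans (cong (f zero +_) (Σfin-split a b (λ x → f (suc x)))) (sym (+-assoc (f zero) _ _))

Σfin-combine : ∀ a b (f : Fin (a * b) → ℕ) →
               Σfin (a * b) f ≡ Σfin a (λ c → Σfin b (λ x → f (combine c x)))
Σfin-combine zero    b f = refl
Σfin-combine (suc a) b f =
  trans (Σfin-split b (a * b) f) (cong (Σfin b (λ x → f (x ↑ˡ (a * b))) +_) (Σfin-combine a b (λ y → f (b ↑ʳ y))))

Σ< : ℕ → (ℕ → ℕ) → ℕ
Σ< zero    f = 0
Σ< (suc n) f = f 0 + Σ< n (λ e → f (suc e))

Σfin-toℕ : ∀ n (f : ℕ → ℕ) → Σfin n (λ x → f (toℕ x)) ≡ Σ< n f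
Σfin-toℕ zero    f = refl
Σfin-toℕ (suc n) f = cong (f 0 +_) (Σfin-toℕ n (λ e → f (suc e)))

Σ<-cong : ∀ n {f g : ℕ → ℕ} → (∀ e → f e ≡ g e) → Σ< n f ≡ Σ< n g
Σ<-cong zero    f≗g = refl
Σ<-cong (suc n) f≗g = cong₂ _+_ (f≗g 0) (Σ<-cong n (λ e → f≗g (suc e)))

Σ<-split : ∀ a b (f : ℕ → ℕ) → Σ< (a + b) f ≡ Σ< a f + Σ< b (λ d → f (a + d))
Σ<-split zero    b f = refl
Σ<-split (suc a) b f =
  trans (cong (f 0 +_) (Σ<-split a b (λ e → f (suc e)))) (sym (+-assoc (f 0) _ _))

Σ<-distrib : ∀ n (f g : ℕ → ℕ) → Σ< n (λ e → f e + g e) ≡ Σ< n f + Σ< n g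
Σ<-distrib zero    f g = refl
Σ<-distrib (suc n) f g = begin
  f 0 + g 0 + Σ< n (λ e → f (suc e) + g (suc e))                 ≡⟨ cong (f 0 + g 0 +_) (Σ<-distrib n _ _) ⟩
  f 0 + g 0 + (Σ< n (λ e → f (suc e)) + Σ< n (λ e → g (suc e)))  ≡⟨ interchange (f 0) (g 0) _ _ ⟩
  f 0 + Σ< n (λ e → f (suc e)) + (g 0 + Σ< n (λ e → g (suc e)))  ∎
  where open ≡-Reasoning

Σ<-const : ∀ n a → Σ< n (λ _ → a) ≡ n * a
Σ<-const zero    a = refl
Σ<-const (suc n) a = cong (a +_) (Σ<-const n a)

Σ<-gauss : ∀ n k → Σ< n (λ e → e * k + e * k) + n * k ≡ n * n * k
Σ<-gauss zero    k = refl
Σ<-gauss (suc n) k = begin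
  Σ< n (λ e → suc e * k + suc e * k) + suc n * k
    ≡⟨ cong (_+ suc n * k) (Σ<-cong n (λ e → shift e k)) ⟩
  Σ< n (λ e → (e * k + e * k) + (k + k)) + suc n * k
    ≡⟨ cong (_+ suc n * k) (trans (Σ<-distrib n _ _) (cong (Σ< n (λ e → e * k + e * k) +_) (Σ<-const n (k + k)))) ⟩
  Σ< n (λ e → e * k + e * k) + n * (k + k) + suc n * k
    ≡⟨ regroup (Σ< n (λ e → e * k + e * k)) n k ⟩
  (Σ< n (λ e → e * k + e * k) + n * k) + (n * k + n * k + k)
    ≡⟨ cong (_+ (n * k + n * k + k)) (Σ<-gauss n k) ⟩
  n * n * k + (n * k + n * k + k)
    ≡⟨ square n k ⟩
  suc n * suc n * k ∎
  where
  open ≡-Reasoning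
  shift : ∀ e k → suc e * k + suc e * k ≡ (e * k + e * k) + (k + k)
  shift = solve-∀
  regroup : ∀ s n k → s + n * (k + k) + suc n * k ≡ (s + n * k) + (n * k + n * k + k)
  regroup = solve-∀
  square : ∀ n k → n * n * k + (n * k + n * k + k) ≡ suc n * suc n * k
  square = solve-∀

-- Ranks of the copies

data Parity : ℕ → Set where
  even : ∀ a → Parity (a + a)
  odd  : ∀ a → Parity (suc (a + a))

parity : ∀ c → Parity c
parity zero          = even 0
parity (suc zero)    = odd 0
parity (suc (suc c)) with parity c
... | even a = subst Parity (cong suc (+-suc a a)) (even (suc a))
... | odd a  = subst Parity (cong (λ x → suc (suc x)) (+-suc a a)) (odd (suc a))

⌊a+a/2⌋≡a : ∀ a → ⌊ a + a /2⌋ ≡ a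
⌊a+a/2⌋≡a zero    = refl
⌊a+a/2⌋≡a (suc a) = trans (cong (λ x → ⌊ suc x /2⌋) (+-suc a a)) (cong suc (⌊a+a/2⌋≡a a))

interleave : ℕ → ℕ → ℕ
interleave h zero          = zero
interleave h (suc zero)    = h
interleave h (suc (suc c)) = suc (interleave h c)

interleave-even : ∀ h a → interleave h (a + a) ≡ a
interleave-even h zero    = refl
interleave-even h (suc a) rewrite +-suc a a = cong suc (interleave-even h a)

interleave-odd : ∀ h a → interleave h (suc (a + a)) ≡ h + a
interleave-odd h zero    = sym (+-identityʳ h)
interleave-odd h (suc a) rewrite +-suc a a = trans (cong suc (interleave-odd h a)) (sym (+-suc h a))

interleave-pair : ∀ h c → interleave h c + interleave h (suc c) ≡ h + c
interleave-pair h zero          = +-comm 0 h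
interleave-pair h (suc zero)    = refl
interleave-pair h (suc (suc c)) = begin
  suc (interleave h c + suc (interleave h (suc c)))  ≡⟨ cong suc (+-suc _ _) ⟩
  suc (suc (interleave h c + interleave h (suc c)))  ≡⟨ cong (λ x → suc (suc x)) (interleave-pair h c) ⟩
  suc (suc (h + c))                                   ≡⟨ cong suc (+-suc h c) ⟨
  suc (h + suc c)                                     ≡⟨ +-suc h (suc c) ⟨
  h + suc (suc c)                                     ∎
  where open ≡-Reasoning

a+a<n⇒a<⌈n/2⌉ : ∀ {a n} → a + a < n → a < ⌈ n /2⌉
a+a<n⇒a<⌈n/2⌉ {a} {n} a+a<n = subst (_≤ ⌈ n /2⌉) (cong suc (⌊a+a/2⌋≡a a)) (⌈n/2⌉-mono a+a<n)

1+a+a<n⇒a<⌊n/2⌋ : ∀ {a n} → suc (a + a) < n → a < ⌊ n /2⌋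
1+a+a<n⇒a<⌊n/2⌋ {a} {n} 1+a+a<n = subst (_≤ ⌊ n /2⌋) (cong suc (⌊a+a/2⌋≡a a)) (⌊n/2⌋-mono 1+a+a<n)

interleave-< : ∀ K c → c < K → interleave ⌈ K /2⌉ c < K
interleave-< K c c<K with parity c
... | even a rewrite interleave-even ⌈ K /2⌉ a = ≤-<-trans (m≤m+n a a) c<K
... | odd a  rewrite interleave-odd ⌈ K /2⌉ a = begin-strict
  ⌈ K /2⌉ + a        <⟨ +-monoʳ-< ⌈ K /2⌉ (1+a+a<n⇒a<⌊n/2⌋ c<K) ⟩
  ⌈ K /2⌉ + ⌊ K /2⌋  ≡⟨ +-comm ⌈ K /2⌉ ⌊ K /2⌋ ⟩
  ⌊ K /2⌋ + ⌈ K /2⌉  ≡⟨ ⌊n/2⌋+⌈n/2⌉≡n K ⟩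
  K                  ∎
  where open ≤-Reasoning

interleave-injective : ∀ K {c c′} → c < K → c′ < K → interleave ⌈ K /2⌉ c ≡ interleave ⌈ K /2⌉ c′ → c ≡ c′
interleave-injective K {c} {c′} c<K c′<K eq with parity c | parity c′
... | even a | even a′ rewrite interleave-even ⌈ K /2⌉ a | interleave-even ⌈ K /2⌉ a′ =
  cong (λ x → x + x) eq
... | odd a  | odd a′  rewrite interleave-odd ⌈ K /2⌉ a | interleave-odd ⌈ K /2⌉ a′ =
  cong (λ x → suc (x + x)) (+-cancelˡ-≡ ⌈ K /2⌉ a a′ eq)
... | even a | odd a′  rewrite interleave-even ⌈ K /2⌉ a | interleave-odd ⌈ K /2⌉ a′ =
  ⊥-elim (<⇒≱ (a+a<n⇒a<⌈n/2⌉ c<K) (subst (⌈ K /2⌉ ≤_) (sym eq) (m≤m+n ⌈ K /2⌉ a′)))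
... | odd a  | even a′ rewrite interleave-odd ⌈ K /2⌉ a | interleave-even ⌈ K /2⌉ a′ =
  ⊥-elim (<⇒≱ (a+a<n⇒a<⌈n/2⌉ c′<K) (subst (⌈ K /2⌉ ≤_) eq (m≤m+n ⌈ K /2⌉ a)))

-- Throughout j = k − 1: copies and their ranks range over 0, …, j, path edges over 0, …, j − 1.
alternating : ℕ → ℕ → ℕ → ℕ
alternating j zero          c = j ∸ c
alternating j (suc zero)    c = c
alternating j (suc (suc e)) c = alternating j e c

rank : ℕ → ℕ → ℕ → ℕ
rank j zero    c = interleave ⌈ suc j /2⌉ c
rank j (suc e) c = alternating j e c

pathRank : ℕ → ℕ → ℕ → ℕ
pathRank j zero          c = c
pathRank j (suc zero)    c = pred j ∸ c
pathRank j (suc (suc N)) c = pathRank j N c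

slot : ℕ → ℕ → ℕ → ℕ
slot j e c = e * suc j + rank j e c

∸-injective : ∀ {j c c′} → c < suc j → c′ < suc j → j ∸ c ≡ j ∸ c′ → c ≡ c′
∸-injective c<1+j c′<1+j = ∸-cancelˡ-≡ (≤-pred c<1+j) (≤-pred c′<1+j)

alternating-< : ∀ j e c → c < suc j → alternating j e c < suc j
alternating-< j zero          c c<1+j = s≤s (m∸n≤m j c)
alternating-< j (suc zero)    c c<1+j = c<1+j
alternating-< j (suc (suc e)) c c<1+j = alternating-< j e c c<1+j

alternating-injective : ∀ j e {c c′} → c < suc j → c′ < suc j → alternating j e c ≡ alternating j e c′ → c ≡ c′
alternating-injective j zero          = ∸-injective
alternating-injective j (suc zero)    _ _ eq = eq
alternating-injective j (suc (suc e)) = alternating-injective j e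

rank-< : ∀ j e c → c < suc j → rank j e c < suc j
rank-< j zero    = interleave-< (suc j)
rank-< j (suc e) = alternating-< j e

rank-injective : ∀ j e {c c′} → c < suc j → c′ < suc j → rank j e c ≡ rank j e c′ → c ≡ c′
rank-injective j zero    = interleave-injective (suc j)
rank-injective j (suc e) = alternating-injective j e

pathRank-< : ∀ j N c → c < j → pathRank j N c < j
pathRank-< j       zero          c c<j = c<j
pathRank-< (suc j) (suc zero)    c c<j = s≤s (m∸n≤m j c)
pathRank-< j       (suc (suc N)) c c<j = pathRank-< j N c c<j

pathRank-injective : ∀ j N {c c′} → c < j → c′ < j → pathRank j N c ≡ pathRank j N c′ → c ≡ c′
pathRank-injective j       zero          _ _ eq = eq
pathRank-injective (suc j) (suc zero)    = ∸-injective
pathRank-injective j       (suc (suc N)) = pathRank-injective j N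

quotRem-unique : ∀ K {a a′ r r′} → r < K → r′ < K → a * K + r ≡ a′ * K + r′ → a ≡ a′ × r ≡ r′
quotRem-unique K {zero}  {zero}   _   _    eq = refl , eq
quotRem-unique K {zero}  {suc a′} r<K _    eq =
  ⊥-elim (<⇒≱ r<K (subst (K ≤_) (sym eq) (≤-trans (m≤m+n K (a′ * K)) (m≤m+n _ _))))
quotRem-unique K {suc a} {zero}   _   r′<K eq =
  ⊥-elim (<⇒≱ r′<K (subst (K ≤_) eq (≤-trans (m≤m+n K (a * K)) (m≤m+n _ _))))
quotRem-unique K {suc a} {suc a′} r<K r′<K eq
  with refl , r≡r′ ← quotRem-unique K {a} {a′} r<K r′<K
                       (+-cancelˡ-≡ K _ _ (trans (sym (+-assoc K _ _)) (trans eq (+-assoc K _ _))))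
  = refl , r≡r′

slot-< : ∀ j {N e c} → e < N → c < suc j → slot j e c < N * suc j
slot-< j {N} {e} {c} e<N c<K = begin-strict
  e * suc j + rank j e c  <⟨ +-monoʳ-< (e * suc j) (rank-< j e c c<K) ⟩
  e * suc j + suc j       ≡⟨ +-comm (e * suc j) (suc j) ⟩
  suc e * suc j           ≤⟨ *-monoˡ-≤ (suc j) e<N ⟩
  N * suc j               ∎
  where open ≤-Reasoning

slot-injective : ∀ j {e e′ c c′} → c < suc j → c′ < suc j → slot j e c ≡ slot j e′ c′ → e ≡ e′ × c ≡ c′
slot-injective j {e} {e′} {c} {c′} c<K c′<K eq
  with refl , rank≡ ← quotRem-unique (suc j) {e} {e′} (rank-< j e c c<K) (rank-< j e′ c′ c′<K) eq
  = refl , rank-injective j e c<K c′<K rank≡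

reversal-pair : ∀ c t → (suc (c + t) ∸ c) + (c + t ∸ c) ≡ suc t + t
reversal-pair c t = cong₂ _+_ (trans (cong (_∸ c) (sym (+-suc c t))) (m+n∸m≡n c (suc t))) (m+n∸m≡n c t)

alternating-pairs : ∀ N c t → let j = suc (c + t) in
  Σ< N (λ e → alternating j e c + alternating j e (suc c)) + pathRank j (suc N) c ≡ N * j + t
alternating-pairs zero          c t = m+n∸m≡n c t
alternating-pairs (suc zero)    c t rewrite reversal-pair c t = arith c t
  where
  arith : ∀ c t → suc t + t + 0 + c ≡ 1 * suc (c + t) + t
  arith = solve-∀
alternating-pairs (suc (suc N)) c t rewrite reversal-pair c t = begin
  suc t + t + (c + suc c + S) + pathRank j (suc N) c  ≡⟨ regroup (suc t + t) (c + suc c) S _ ⟩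
  suc t + t + (c + suc c) + (S + pathRank j (suc N) c) ≡⟨ cong (suc t + t + (c + suc c) +_) (alternating-pairs N c t) ⟩
  suc t + t + (c + suc c) + (N * j + t)               ≡⟨ arith N c t ⟩
  suc (suc N) * j + t                                  ∎
  where
  open ≡-Reasoning
  j S : ℕ
  j = suc (c + t)
  S = Σ< N (λ e → alternating j e c + alternating j e (suc c))
  regroup : ∀ a b s p → a + (b + s) + p ≡ a + b + (s + p)
  regroup = solve-∀
  arith : ∀ N c t → suc t + t + (c + suc c) + (N * suc (c + t) + t) ≡ suc (suc N) * suc (c + t) + t
  arith = solve-∀

rank-pairs : ∀ N {j c} → c < j →
  Σ< (suc N) (λ e → rank j e c + rank j e (suc c)) + suc (pathRank j (suc N) c) ≡ ⌈ suc j /2⌉ + suc N * j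
rank-pairs N {c = c} c<j with t , refl ← m≤n⇒∃[o]m+o≡n c<j = begin
  P₀ + S + suc π              ≡⟨ cong (λ x → x + S + suc π) (interleave-pair h c) ⟩
  h + c + S + suc π           ≡⟨ regroup h c S π ⟩
  h + c + suc (S + π)         ≡⟨ cong (λ x → h + c + suc x) (alternating-pairs N c t) ⟩
  h + c + suc (N * j + t)     ≡⟨ arith h N c t ⟩
  h + suc N * j               ∎
  where
  open ≡-Reasoning
  j h P₀ S π : ℕ
  j = suc (c + t)
  h = ⌈ suc j /2⌉
  P₀ = interleave h c + interleave h (suc c)
  S = Σ< N (λ e → alternating j e c + alternating j e (suc c))
  π = pathRank j (suc N) c
  regroup : ∀ a b s p → a + b + s + suc p ≡ a + b + suc (s + p)
  regroup = solve-∀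
  arith : ∀ h N c t → h + c + suc (N * suc (c + t) + t) ≡ h + suc N * suc (c + t)
  arith = solve-∀

slot-pairs : ∀ {N j c} → 0 < N → c < j →
  Σ< N (λ e → suc (slot j e c) + suc (slot j e (suc c))) + suc (N * suc j + pathRank j N c)
    ≡ N * ((N + 1) * suc j + 1) + ⌈ suc j /2⌉
slot-pairs {suc N} {j} {c} _ c<j = begin
  Σ< N₁ (λ e → suc (slot j e c) + suc (slot j e (suc c))) + suc (N₁ * K + π)
    ≡⟨ cong (_+ suc (N₁ * K + π)) (Σ<-cong N₁ (λ e → split (e * K) (rank j e c) (rank j e (suc c)))) ⟩
  Σ< N₁ (λ e → (e * K + e * K + P e) + 2) + suc (N₁ * K + π)
    ≡⟨ cong (_+ suc (N₁ * K + π)) (Σ<-distrib N₁ (λ e → e * K + e * K + P e) (λ _ → 2)) ⟩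
  Σ< N₁ (λ e → e * K + e * K + P e) + Σ< N₁ (λ _ → 2) + suc (N₁ * K + π)
    ≡⟨ cong₂ (λ x y → x + y + suc (N₁ * K + π)) (Σ<-distrib N₁ (λ e → e * K + e * K) P) (Σ<-const N₁ 2) ⟩
  Σ< N₁ (λ e → e * K + e * K) + Σ< N₁ P + N₁ * 2 + suc (N₁ * K + π)
    ≡⟨ regroup (Σ< N₁ (λ e → e * K + e * K)) (Σ< N₁ P) N₁ K π ⟩
  (Σ< N₁ (λ e → e * K + e * K) + N₁ * K) + (Σ< N₁ P + suc π) + N₁ * 2
    ≡⟨ cong₂ (λ x y → x + y + N₁ * 2) (Σ<-gauss N₁ K) (rank-pairs N c<j) ⟩
  N₁ * N₁ * K + (⌈ K /2⌉ + N₁ * j) + N₁ * 2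
    ≡⟨ arith N₁ j ⌈ K /2⌉ ⟩
  N₁ * ((N₁ + 1) * K + 1) + ⌈ K /2⌉ ∎
  where
  open ≡-Reasoning
  K N₁ π : ℕ
  K = suc j
  N₁ = suc N
  π = pathRank j N₁ c
  P : ℕ → ℕ
  P e = rank j e c + rank j e (suc c)
  split : ∀ x y z → suc (x + y) + suc (x + z) ≡ (x + x + (y + z)) + 2
  split = solve-∀
  regroup : ∀ g s n k p → g + s + n * 2 + suc (n * k + p) ≡ (g + n * k) + (s + suc p) + n * 2
  regroup = solve-∀
  arith : ∀ n j h → n * n * suc j + (h + n * j) + n * 2 ≡ n * ((n + 1) * suc j + 1) + h
  arith = solve-∀

injective⇒surjective : ∀ {n} (f : Fin n → Fin n) → Injective _≡_ _≡_ f → ∀ y → ∃ λ x → f x ≡ y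
injective⇒surjective {suc n} f f-inj y with any? (λ x → f x Fin.≟ y)
... | yes hit = hit
... | no miss = ⊥-elim (<-irrefl refl (injective⇒≤ {f = avoid} avoid-injective))
  where
  avoid : Fin (suc n) → Fin n
  avoid x = Fin.punchOut {i = y} (λ eq → miss (x , sym eq))
  avoid-injective : Injective _≡_ _≡_ avoid
  avoid-injective {x} {x′} eq = f-inj (punchOut-injective (λ e → miss (x , sym e)) (λ e → miss (x′ , sym e)) eq)

injective⇒⤖ : ∀ {a b} (f : Fin a ⊎ Fin b → Fin (a + b)) → Injective _≡_ _≡_ f → (Fin a ⊎ Fin b) ⤖ Fin (a + b)
injective⇒⤖ {a} {b} f f-inj = mk⤖ (f-inj , surjective)
  where
  splitAt-injective : Injective _≡_ _≡_ (splitAt a {b})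
  splitAt-injective {x} {x′} eq = trans (sym (join-splitAt a b x)) (trans (cong (join a b) eq) (join-splitAt a b x′))
  surjective : ∀ y → ∃ λ x → ∀ {z} → z ≡ x → f z ≡ y
  surjective y with injective⇒surjective (λ x → f (splitAt a x)) (λ eq → splitAt-injective (f-inj eq)) y
  ... | x , fx≡y = splitAt a x , λ { refl → fx≡y }

↑ˡ≢↑ʳ : ∀ {a b} (x : Fin a) (y : Fin b) → x ↑ˡ b ≢ a ↑ʳ y
↑ˡ≢↑ʳ {a} {b} x y eq with () ← trans (sym (splitAt-↑ˡ a x b)) (trans (cong (splitAt a) eq) (splitAt-↑ʳ a b y))

inject₁≢suc : ∀ {j} (i : Fin j) → inject₁ i ≢ suc i
inject₁≢suc (suc i) eq = inject₁≢suc i (Finₚ.suc-injective eq)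

SameSub-sym : ∀ {Γ} (S T : Subgraph Γ) → SameSub S T → SameSub T S
SameSub-sym _ _ (sameV , sameE) = (λ x → sym (sameV x)) , (λ e → sym (sameE e))

SameSub-trans : ∀ {Γ} (S T U : Subgraph Γ) → SameSub S T → SameSub T U → SameSub S U
SameSub-trans _ _ _ (sameV , sameE) (sameV′ , sameE′) =
  (λ x → trans (sameV x) (sameV′ x)) , (λ e → trans (sameE e) (sameE′ e))

weight-cong : ∀ {Γ} (f : Labeling Γ) {S T : Subgraph Γ} → SameSub S T → weight f S ≡ weight f T
weight-cong {Γ} f (sameV , sameE) = cong₂ _+_
  (Σfin-cong (nV Γ) (λ x → cong (λ b → if b then label {Γ} f (inj₁ x) else 0) (sameV x)))
  (Σfin-cong (nE Γ) (λ e → cong (λ b → if b then label {Γ} f (inj₂ e) else 0) (sameE e)))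

-- i ↦ the position of T i among the listed subgraphs is injective, hence onto.
exactly⇒exhausted : ∀ {Γ H t} → ExactlyIsoSubgraphs Γ H t →
                    (T : Fin t → Subgraph Γ) → (∀ i → IsoTo Γ (T i) H) →
                    (∀ i i′ → SameSub (T i) (T i′) → i ≡ i′) →
                    ∀ S → IsoTo Γ S H → ∃ λ i → SameSub S (T i)
exactly⇒exhausted {t = t} (L , _ , _ , complete) T T≅H T-distinct S S≅H = i , SameSub-trans S (L l) (T i) S~L (L~T (proj₂ preimage))
  where
  index : Fin t → Fin t
  index i = proj₁ (complete (T i) (T≅H i))
  L~T : ∀ {i l} → index i ≡ l → SameSub (L l) (T i)
  L~T {i} refl = SameSub-sym (T i) (L (index i)) (proj₂ (complete (T i) (T≅H i)))
  index-injective : ∀ {i i′} → index i ≡ index i′ → i ≡ i′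
  index-injective {i} {i′} eq =
    T-distinct i i′ (SameSub-trans (T i) (L (index i′)) (T i′) (SameSub-sym (L (index i′)) (T i) (L~T eq)) (L~T refl))
  l : Fin t
  l = proj₁ (complete S S≅H)
  S~L : SameSub S (L l)
  S~L = proj₂ (complete S S≅H)
  preimage : ∃ λ i → index i ≡ l
  preimage = injective⇒surjective index index-injective l
  i : Fin t
  i = proj₁ preimage

-- Blocks of consecutive copies

inBlock : ∀ {j} → Fin j → Fin (suc j) → Bool
inBlock zero    zero          = true
inBlock zero    (suc zero)    = true
inBlock zero    (suc (suc _)) = false
inBlock (suc i) zero          = false
inBlock (suc i) (suc c)       = inBlock i c

blockCopy : ∀ {j} → Fin j → Fin 2 → Fin (suc j)
blockCopy i zero       = inject₁ i
blockCopy i (suc zero) = suc i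

inBlock-blockCopy : ∀ {j} (i : Fin j) a → inBlock i (blockCopy i a) ≡ true
inBlock-blockCopy zero    zero       = refl
inBlock-blockCopy zero    (suc zero) = refl
inBlock-blockCopy (suc i) zero       = inBlock-blockCopy i zero
inBlock-blockCopy (suc i) (suc zero) = inBlock-blockCopy i (suc zero)

inBlock⇒blockCopy : ∀ {j} (i : Fin j) c → inBlock i c ≡ true → ∃ λ a → blockCopy i a ≡ c
inBlock⇒blockCopy zero    zero       _ = zero , refl
inBlock⇒blockCopy zero    (suc zero) _ = suc zero , refl
inBlock⇒blockCopy (suc i) (suc c)    c∈i with inBlock⇒blockCopy i c c∈i
... | zero     , refl = zero , refl
... | suc zero , refl = suc zero , refl

blockCopy-injective : ∀ {j} (i : Fin j) {a b : Fin 2} → blockCopy i a ≡ blockCopy i b → a ≡ b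
blockCopy-injective i {zero}     {zero}     _  = refl
blockCopy-injective i {zero}     {suc zero} eq = ⊥-elim (inject₁≢suc i eq)
blockCopy-injective i {suc zero} {zero}     eq = ⊥-elim (inject₁≢suc i (sym eq))
blockCopy-injective i {suc zero} {suc zero} _  = refl

Σfin-inBlock : ∀ {j} (i : Fin j) (g : Fin (suc j) → ℕ) →
               Σfin (suc j) (λ c → if inBlock i c then g c else 0) ≡ g (inject₁ i) + g (suc i)
Σfin-inBlock {suc j} zero    g =
  trans (cong (λ x → g zero + (g (suc zero) + x)) (Σfin-zero j)) (cong (g zero +_) (+-identityʳ _))
Σfin-inBlock {suc j} (suc i) g = Σfin-inBlock i (λ c → g (suc c))

_==_ : ∀ {j} → Fin j → Fin j → Bool
zero  == zero  = true
zero  == suc _ = false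
suc _ == zero  = false
suc i == suc p = i == p

==-refl : ∀ {j} (i : Fin j) → (i == i) ≡ true
==-refl zero    = refl
==-refl (suc i) = ==-refl i

==⇒≡ : ∀ {j} (i p : Fin j) → (i == p) ≡ true → i ≡ p
==⇒≡ zero    zero    _  = refl
==⇒≡ (suc i) (suc p) eq = cong suc (==⇒≡ i p eq)

Σfin-== : ∀ {j} (i : Fin j) (g : Fin j → ℕ) → Σfin j (λ p → if i == p then g p else 0) ≡ g i
Σfin-== {suc j} zero    g = trans (cong (g zero +_) (Σfin-zero j)) (+-identityʳ _)
Σfin-== {suc j} (suc i) g = Σfin-== i (λ p → g (suc p))

Σfin-blockGrid : ∀ {j} a (i : Fin j) (f : Fin (suc j * a) → ℕ) (g : Fin (suc j) → Fin a → ℕ) →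
                 (∀ c x → f (combine c x) ≡ (if inBlock i c then g c x else 0)) →
                 Σfin (suc j * a) f ≡ Σfin a (g (inject₁ i)) + Σfin a (g (suc i))
Σfin-blockGrid {j} a i f g f≗g = begin
  Σfin (suc j * a) f
    ≡⟨ Σfin-combine (suc j) a f ⟩
  Σfin (suc j) (λ c → Σfin a (λ x → f (combine c x)))
    ≡⟨ Σfin-cong (suc j) (λ c → trans (Σfin-cong a (f≗g c)) (Σfin-if a (inBlock i c) (g c))) ⟩
  Σfin (suc j) (λ c → if inBlock i c then Σfin a (g c) else 0)
    ≡⟨ Σfin-inBlock i (λ c → Σfin a (g c)) ⟩
  Σfin a (g (inject₁ i)) + Σfin a (g (suc i)) ∎
  where open ≡-Reasoning

-- The graph P_k(G,v), its blocks and its labelling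

module PathOfCopies (G : Graph) (v : Fin (nV G)) (j : ℕ) where

  n m K : ℕ
  n = nV G
  m = nE G
  K = suc j

  Γ : Graph
  Γ = Pk K G v

  data VertexView : Fin (K * n) → Set where
    vertex : ∀ (c : Fin K) (x : Fin n) → VertexView (combine c x)

  vertexView : ∀ z → VertexView z
  vertexView z = subst VertexView (combine-remQuot {K} n z) (vertex (quotient {K} n z) (remainder {K} n z))

  data EdgeView : Fin (K * m + j) → Set where
    copyEdge : ∀ (c : Fin K) (d : Fin m) → EdgeView (combine c d ↑ˡ j)
    pathEdge : ∀ p → EdgeView ((K * m) ↑ʳ p)

  edgeView : ∀ e → EdgeView e
  edgeView e with splitAt (K * m) e in eq
  ... | inj₁ e′ = subst EdgeView (trans (cong (_↑ˡ j) (combine-remQuot {K} m e′)) (splitAt⁻¹-↑ˡ eq))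
                                 (copyEdge (quotient {K} m e′) (remainder {K} m e′))
  ... | inj₂ p  = subst EdgeView (splitAt⁻¹-↑ʳ eq) (pathEdge p)

  ends-copyEdge : ∀ (c : Fin K) (d : Fin m) →
                  ends Γ (combine c d ↑ˡ j) ≡ (combine c (proj₁ (ends G d)) , combine c (proj₂ (ends G d)))
  ends-copyEdge c d rewrite splitAt-↑ˡ (K * m) (combine c d) j =
    cong (λ (c′ , d′) → combine c′ (proj₁ (ends G d′)) , combine c′ (proj₂ (ends G d′))) (remQuot-combine c d)

  ends-pathEdge : ∀ (p : Fin j) → ends Γ ((K * m) ↑ʳ p) ≡ (combine (inject₁ p) v , combine (suc p) v)
  ends-pathEdge p rewrite splitAt-↑ʳ (K * m) j p = refl

  inBlockV : Fin j → Fin (K * n) → Bool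
  inBlockV i z = inBlock i (quotient {K} n z)

  inBlockE : Fin j → Fin (K * m + j) → Bool
  inBlockE i e = [ (λ e′ → inBlock i (quotient {K} m e′)) , i ==_ ]′ (splitAt (K * m) e)

  inBlockV-vertex : ∀ i c x → inBlockV i (combine c x) ≡ inBlock i c
  inBlockV-vertex i c x = cong (inBlock i ∘ proj₁) (remQuot-combine c x)

  inBlockE-copyEdge : ∀ i c d → inBlockE i (combine c d ↑ˡ j) ≡ inBlock i c
  inBlockE-copyEdge i c d rewrite splitAt-↑ˡ (K * m) (combine c d) j = cong (inBlock i ∘ proj₁) (remQuot-combine c d)

  inBlockE-pathEdge : ∀ i p → inBlockE i ((K * m) ↑ʳ p) ≡ (i == p)
  inBlockE-pathEdge i p rewrite splitAt-↑ʳ (K * m) j p = refl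

  block-closed : ∀ i e → inBlockE i e ≡ true →
                 (inBlockV i (proj₁ (ends Γ e)) ≡ true) × (inBlockV i (proj₂ (ends Γ e)) ≡ true)
  block-closed i e e∈i with edgeView e
  ... | copyEdge c d rewrite ends-copyEdge c d =
    trans (inBlockV-vertex i c _) c∈i , trans (inBlockV-vertex i c _) c∈i
    where c∈i = trans (sym (inBlockE-copyEdge i c d)) e∈i
  ... | pathEdge p with ==⇒≡ i p (trans (sym (inBlockE-pathEdge i p)) e∈i)
  ...   | refl rewrite ends-pathEdge i =
    trans (inBlockV-vertex i _ v) (inBlock-blockCopy i zero) , trans (inBlockV-vertex i _ v) (inBlock-blockCopy i (suc zero))

  block : Fin j → Subgraph Γ
  block i = record { inV = inBlockV i ; inE = inBlockE i ; closed = block-closed i }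

  block-distinct : ∀ i i′ → SameSub (block i) (block i′) → i ≡ i′
  block-distinct i i′ (_ , sameE) = sym (==⇒≡ i′ i (begin
    i′ == i                         ≡⟨ inBlockE-pathEdge i′ i ⟨
    inBlockE i′ ((K * m) ↑ʳ i)      ≡⟨ sameE _ ⟨
    inBlockE i ((K * m) ↑ʳ i)       ≡⟨ inBlockE-pathEdge i i ⟩
    i == i                          ≡⟨ ==-refl i ⟩
    true                            ∎))
    where open ≡-Reasoning

module BlockIso (G : Graph) (v : Fin (nV G)) (j : ℕ) where

  open PathOfCopies G v j
  module P₂ = PathOfCopies G v 1

  φ : Fin j → Fin (2 * n) → Fin (K * n)
  φ i y = combine (blockCopy i (quotient {2} n y)) (remainder {2} n y)

  ψ : Fin j → Fin (2 * m + 1) → Fin (K * m + j)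
  ψ i = [ (λ d → combine (blockCopy i (quotient {2} m d)) (remainder {2} m d) ↑ˡ j) , (λ _ → (K * m) ↑ʳ i) ]′
        ∘ splitAt (2 * m)

  φ-vertex : ∀ i a x → φ i (combine a x) ≡ combine (blockCopy i a) x
  φ-vertex i a x = cong (λ (a′ , x′) → combine (blockCopy i a′) x′) (remQuot-combine a x)

  ψ-copyEdge : ∀ i a d → ψ i (combine a d ↑ˡ 1) ≡ combine (blockCopy i a) d ↑ˡ j
  ψ-copyEdge i a d rewrite splitAt-↑ˡ (2 * m) (combine a d) 1 =
    cong (λ (a′ , d′) → combine (blockCopy i a′) d′ ↑ˡ j) (remQuot-combine a d)

  ψ-pathEdge : ∀ i p → ψ i ((2 * m) ↑ʳ p) ≡ (K * m) ↑ʳ i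
  ψ-pathEdge i p rewrite splitAt-↑ʳ (2 * m) 1 p = refl

  φ-injective : ∀ i → Injective _≡_ _≡_ (φ i)
  φ-injective i {y} {y′} eq with P₂.vertexView y | P₂.vertexView y′
  ... | vertex a x | vertex a′ x′
    with combine-injective (blockCopy i a) x (blockCopy i a′) x′ (trans (sym (φ-vertex i a x)) (trans eq (φ-vertex i a′ x′)))
  ...   | ca≡ca′ , refl = cong (λ a″ → combine a″ x) (blockCopy-injective i {a} {a′} ca≡ca′)

  φ-onto : ∀ i z → inBlockV i z ≡ true → ∃ λ y → φ i y ≡ z
  φ-onto i z z∈i with vertexView z
  ... | vertex c x with inBlock⇒blockCopy i c (trans (sym (inBlockV-vertex i c x)) z∈i)
  ...   | a , refl = combine a x , φ-vertex i a x

  φ-into : ∀ i y → inBlockV i (φ i y) ≡ true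
  φ-into i y with P₂.vertexView y
  ... | vertex a x rewrite φ-vertex i a x = trans (inBlockV-vertex i (blockCopy i a) x) (inBlock-blockCopy i a)

  ψ-injective : ∀ i → Injective _≡_ _≡_ (ψ i)
  ψ-injective i {d} {d′} eq with P₂.edgeView d | P₂.edgeView d′
  ... | copyEdge a x | copyEdge a′ x′
    with combine-injective (blockCopy i a) x (blockCopy i a′) x′
           (↑ˡ-injective j _ _ (trans (sym (ψ-copyEdge i a x)) (trans eq (ψ-copyEdge i a′ x′))))
  ...   | ca≡ca′ , refl = cong (λ a″ → combine a″ x ↑ˡ 1) (blockCopy-injective i {a} {a′} ca≡ca′)
  ψ-injective i eq | copyEdge a x | pathEdge p =
    ⊥-elim (↑ˡ≢↑ʳ _ i (trans (sym (ψ-copyEdge i a x)) (trans eq (ψ-pathEdge i p))))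
  ψ-injective i eq | pathEdge p | copyEdge a x =
    ⊥-elim (↑ˡ≢↑ʳ _ i (trans (sym (ψ-copyEdge i a x)) (trans (sym eq) (ψ-pathEdge i p))))
  ψ-injective i eq | pathEdge zero | pathEdge zero = refl

  ψ-onto : ∀ i e → inBlockE i e ≡ true → ∃ λ d → ψ i d ≡ e
  ψ-onto i e e∈i with edgeView e
  ... | copyEdge c d with inBlock⇒blockCopy i c (trans (sym (inBlockE-copyEdge i c d)) e∈i)
  ...   | a , refl = combine a d ↑ˡ 1 , ψ-copyEdge i a d
  ψ-onto i e e∈i | pathEdge p with ==⇒≡ i p (trans (sym (inBlockE-pathEdge i p)) e∈i)
  ...   | refl = (2 * m) ↑ʳ zero , ψ-pathEdge i zero

  ψ-into : ∀ i d → inBlockE i (ψ i d) ≡ true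
  ψ-into i d with P₂.edgeView d
  ... | copyEdge a x rewrite ψ-copyEdge i a x = trans (inBlockE-copyEdge i (blockCopy i a) x) (inBlock-blockCopy i a)
  ... | pathEdge p   rewrite ψ-pathEdge i p = trans (inBlockE-pathEdge i i) (==-refl i)

  ψ-ends : ∀ i d → SamePair (ends Γ (ψ i d)) (φ i (proj₁ (ends P₂.Γ d)) , φ i (proj₂ (ends P₂.Γ d)))
  ψ-ends i d with P₂.edgeView d
  ... | copyEdge a x rewrite ψ-copyEdge i a x | ends-copyEdge (blockCopy i a) x | P₂.ends-copyEdge a x
                           | φ-vertex i a (proj₁ (ends G x)) | φ-vertex i a (proj₂ (ends G x)) = inj₁ (refl , refl)
  ... | pathEdge zero rewrite ψ-pathEdge i zero | ends-pathEdge i | P₂.ends-pathEdge zero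
                           | φ-vertex i zero v | φ-vertex i (suc zero) v = inj₁ (refl , refl)

  block-iso : ∀ i → IsoTo Γ (block i) P₂.Γ
  block-iso i = φ i , ψ i , φ-injective i , φ-onto i , φ-into i , ψ-injective i , ψ-onto i , ψ-into i , ψ-ends i

module Labelling (G : Graph) (v : Fin (nV G)) (j : ℕ) where

  open PathOfCopies G v j

  N : ℕ
  N = n + m

  value : Fin (K * n) ⊎ Fin (K * m + j) → ℕ
  value (inj₁ z) = slot j (toℕ (remainder {K} n z)) (toℕ (quotient {K} n z))
  value (inj₂ e) = [ (λ e′ → slot j (n + toℕ (remainder {K} m e′)) (toℕ (quotient {K} m e′)))
                   , (λ p → N * K + pathRank j N (toℕ p)) ]′ (splitAt (K * m) e)

  value-vertex : ∀ (c : Fin K) (x : Fin n) → value (inj₁ (combine c x)) ≡ slot j (toℕ x) (toℕ c)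
  value-vertex c x = cong (λ (c′ , x′) → slot j (toℕ x′) (toℕ c′)) (remQuot-combine c x)

  value-copyEdge : ∀ (c : Fin K) (d : Fin m) → value (inj₂ (combine c d ↑ˡ j)) ≡ slot j (n + toℕ d) (toℕ c)
  value-copyEdge c d rewrite splitAt-↑ˡ (K * m) (combine c d) j =
    cong (λ (c′ , d′) → slot j (n + toℕ d′) (toℕ c′)) (remQuot-combine c d)

  value-pathEdge : ∀ (p : Fin j) → value (inj₂ ((K * m) ↑ʳ p)) ≡ N * K + pathRank j N (toℕ p)
  value-pathEdge p rewrite splitAt-↑ʳ (K * m) j p = refl

  labelCount : N * K + j ≡ K * n + (K * m + j)
  labelCount = arith n m K j
    where
    arith : ∀ n m K j → (n + m) * K + j ≡ K * n + (K * m + j)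
    arith = solve-∀

  slot<N*K : ∀ {e} (c : Fin K) → e < N → slot j e (toℕ c) < N * K
  slot<N*K c e<N = slot-< j e<N (toℕ<n c)

  vertex-value< : ∀ z → value (inj₁ z) < K * n
  vertex-value< z with vertexView z
  ... | vertex c x rewrite value-vertex c x = subst (slot j (toℕ x) (toℕ c) <_) (*-comm n K) (slot-< j (toℕ<n x) (toℕ<n c))

  value<labelCount : ∀ z → value z < K * n + (K * m + j)
  value<labelCount (inj₁ z) = <-≤-trans (vertex-value< z) (m≤m+n (K * n) (K * m + j))
  value<labelCount (inj₂ e) with edgeView e
  ... | copyEdge c d rewrite value-copyEdge c d =
    <-≤-trans (slot<N*K c (+-monoʳ-< n (toℕ<n d))) (≤-trans (m≤m+n (N * K) j) (≤-reflexive labelCount))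
  ... | pathEdge p rewrite value-pathEdge p =
    <-≤-trans (+-monoʳ-< (N * K) (pathRank-< j N (toℕ p) (toℕ<n p))) (≤-reflexive labelCount)

  slot≢path : ∀ {e} (c : Fin K) (p : Fin j) → e < N → slot j e (toℕ c) ≢ N * K + pathRank j N (toℕ p)
  slot≢path c p e<N = <⇒≢ (<-≤-trans (slot<N*K c e<N) (m≤m+n _ _))

  vertex≢edge : ∀ z e → value (inj₁ z) ≢ value (inj₂ e)
  vertex≢edge z e eq with vertexView z | edgeView e
  ... | vertex c x | copyEdge c′ d =
    <⇒≢ (≤-trans (toℕ<n x) (m≤m+n n _))
        (proj₁ (slot-injective j (toℕ<n c) (toℕ<n c′) (trans (sym (value-vertex c x)) (trans eq (value-copyEdge c′ d)))))
  ... | vertex c x | pathEdge p =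
    slot≢path c p (≤-trans (toℕ<n x) (m≤m+n n m)) (trans (sym (value-vertex c x)) (trans eq (value-pathEdge p)))

  copyEdge≢pathEdge : ∀ c d p → value (inj₂ (combine c d ↑ˡ j)) ≢ value (inj₂ ((K * m) ↑ʳ p))
  copyEdge≢pathEdge c d p eq =
    slot≢path c p (+-monoʳ-< n (toℕ<n d)) (trans (sym (value-copyEdge c d)) (trans eq (value-pathEdge p)))

  value-injective : Injective _≡_ _≡_ value
  value-injective {inj₁ z} {inj₁ z′} eq with vertexView z | vertexView z′
  ... | vertex c x | vertex c′ x′
    with x≡x′ , c≡c′ ← slot-injective j (toℕ<n c) (toℕ<n c′)
                         (trans (sym (value-vertex c x)) (trans eq (value-vertex c′ x′)))
    = cong inj₁ (cong₂ combine (toℕ-injective c≡c′) (toℕ-injective x≡x′))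
  value-injective {inj₁ z} {inj₂ e} eq = ⊥-elim (vertex≢edge z e eq)
  value-injective {inj₂ e} {inj₁ z} eq = ⊥-elim (vertex≢edge z e (sym eq))
  value-injective {inj₂ e} {inj₂ e′} eq with edgeView e | edgeView e′
  ... | copyEdge c d | copyEdge c′ d′
    with d≡d′ , c≡c′ ← slot-injective j (toℕ<n c) (toℕ<n c′)
                         (trans (sym (value-copyEdge c d)) (trans eq (value-copyEdge c′ d′)))
    = cong inj₂ (cong (_↑ˡ j) (cong₂ combine (toℕ-injective c≡c′) (toℕ-injective (+-cancelˡ-≡ n _ _ d≡d′))))
  ... | copyEdge c d | pathEdge p = ⊥-elim (copyEdge≢pathEdge c d p eq)
  ... | pathEdge p | copyEdge c d = ⊥-elim (copyEdge≢pathEdge c d p (sym eq))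
  ... | pathEdge p | pathEdge p′ =
    cong (λ p″ → inj₂ ((K * m) ↑ʳ p″)) (toℕ-injective (pathRank-injective j N (toℕ<n p) (toℕ<n p′)
      (+-cancelˡ-≡ (N * K) _ _ (trans (sym (value-pathEdge p)) (trans eq (value-pathEdge p′))))))

  labelling : Labeling Γ
  labelling = injective⇒⤖ (λ z → fromℕ< (value<labelCount z))
    (λ eq → value-injective (trans (sym (toℕ-fromℕ< _)) (trans (cong toℕ eq) (toℕ-fromℕ< _))))

  label-value : ∀ z → label {Γ} labelling z ≡ suc (value z)
  label-value z = cong suc (toℕ-fromℕ< (value<labelCount z))

  copyLabelSum : ∀ a → (ℕ → ℕ) → ℕ → ℕ
  copyLabelSum a element c = Σ< a (λ e → suc (slot j (element e) c))

  Σfin-block : ∀ a element (i : Fin j) (f : Fin (K * a) → ℕ) →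
               (∀ c x → f (combine c x) ≡ (if inBlock i c then suc (slot j (element (toℕ x)) (toℕ c)) else 0)) →
               Σfin (K * a) f ≡ copyLabelSum a element (toℕ i) + copyLabelSum a element (suc (toℕ i))
  Σfin-block a element i f f≗ = trans (Σfin-blockGrid a i f _ f≗)
    (cong₂ _+_ (trans (Σfin-toℕ a _) (cong (copyLabelSum a element) (toℕ-inject₁ i))) (Σfin-toℕ a _))

  if-label : ∀ {b b′ y} z → b ≡ b′ → value z ≡ y →
             (if b then label {Γ} labelling z else 0) ≡ (if b′ then suc y else 0)
  if-label {b} z refl refl = cong (λ l → if b then l else 0) (label-value z)

  vertexWeight : ∀ i → Σfin (K * n) (λ z → if inBlockV i z then label {Γ} labelling (inj₁ z) else 0)
                       ≡ copyLabelSum n (λ e → e) (toℕ i) + copyLabelSum n (λ e → e) (suc (toℕ i))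
  vertexWeight i = Σfin-block n (λ e → e) i _ (λ c x → if-label (inj₁ (combine c x)) (inBlockV-vertex i c x) (value-vertex c x))

  edgeWeight : ∀ i → Σfin (K * m + j) (λ e → if inBlockE i e then label {Γ} labelling (inj₂ e) else 0)
                     ≡ copyLabelSum m (n +_) (toℕ i) + copyLabelSum m (n +_) (suc (toℕ i)) + suc (N * K + pathRank j N (toℕ i))
  edgeWeight i = begin
    Σfin (K * m + j) f
      ≡⟨ Σfin-split (K * m) j f ⟩
    Σfin (K * m) (λ e → f (e ↑ˡ j)) + Σfin j (λ p → f ((K * m) ↑ʳ p))
      ≡⟨ cong₂ _+_ (Σfin-block m (n +_) i _ (λ c d → if-label (inj₂ (combine c d ↑ˡ j)) (inBlockE-copyEdge i c d) (value-copyEdge c d)))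
                   (Σfin-cong j (λ p → if-label (inj₂ ((K * m) ↑ʳ p)) (inBlockE-pathEdge i p) (value-pathEdge p))) ⟩
    E c + E (suc c) + Σfin j (λ p → if i == p then suc (N * K + pathRank j N (toℕ p)) else 0)
      ≡⟨ cong (E c + E (suc c) +_) (Σfin-== i _) ⟩
    E c + E (suc c) + suc (N * K + pathRank j N c) ∎
    where
    open ≡-Reasoning
    f : Fin (K * m + j) → ℕ
    f e = if inBlockE i e then label {Γ} labelling (inj₂ e) else 0
    c : ℕ
    c = toℕ i
    E : ℕ → ℕ
    E = copyLabelSum m (n +_)

  block-weight : ∀ i → weight labelling (block i)
                       ≡ Σ< N (λ e → suc (slot j e (toℕ i)) + suc (slot j e (suc (toℕ i))))
                         + suc (N * K + pathRank j N (toℕ i))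
  block-weight i = begin
    weight labelling (block i)
      ≡⟨ cong₂ _+_ (vertexWeight i) (edgeWeight i) ⟩
    V c + V (suc c) + (E c + E (suc c) + π)
      ≡⟨ regroup (V c) (V (suc c)) (E c) (E (suc c)) π ⟩
    (V c + E c) + (V (suc c) + E (suc c)) + π
      ≡⟨ cong₂ (λ x y → x + y + π) (sym (Σ<-split n m _)) (sym (Σ<-split n m _)) ⟩
    Σ< N (λ e → suc (slot j e c)) + Σ< N (λ e → suc (slot j e (suc c))) + π
      ≡⟨ cong (_+ π) (sym (Σ<-distrib N _ _)) ⟩
    Σ< N (λ e → suc (slot j e c) + suc (slot j e (suc c))) + π ∎
    where
    open ≡-Reasoning
    c π : ℕ
    c = toℕ i
    π = suc (N * K + pathRank j N c)
    V E : ℕ → ℕ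
    V = copyLabelSum n (λ e → e)
    E = copyLabelSum m (n +_)
    regroup : ∀ a a′ b b′ p → a + a′ + (b + b′ + p) ≡ (a + b) + (a′ + b′) + p
    regroup = solve-∀

  vertex-label< : ∀ z → toℕ (Bijection.to labelling (inj₁ z)) < K * n
  vertex-label< z = subst (_< K * n) (sym (toℕ-fromℕ< (value<labelCount (inj₁ z)))) (vertex-value< z)

  block-magic : ∀ i → weight labelling (block i) ≡ N * ((N + 1) * K + 1) + ⌈ K /2⌉
  block-magic i = trans (block-weight i) (slot-pairs (≤-trans (s≤s z≤n) (≤-trans (toℕ<n v) (m≤m+n n m))) (toℕ<n i))

module Covering (G : Graph) (v : Fin (nV G)) (j : ℕ) where

  open PathOfCopies G v (suc j)
  open BlockIso G v (suc j)

  blocks-cover : HCovering Γ P₂.Γ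
  blocks-cover e with edgeView e
  ... | pathEdge p         = block p , block-iso p , trans (inBlockE-pathEdge p p) (==-refl p)
  ... | copyEdge zero d    = block zero , block-iso zero , inBlockE-copyEdge zero zero d
  ... | copyEdge (suc c) d = block c , block-iso c , trans (inBlockE-copyEdge c (suc c) d) (inBlock-blockCopy c (suc zero))

mainTheorem1 : (G : Graph) → Simple G → (v : Fin (nV G)) → (k : ℕ) → 2 ≤ k →
    2 ∣ ((nV G + nE G ∸ 1) * (k ∸ 1)) →
    ExactlyIsoSubgraphs (Pk k G v) (Pk 2 G v) (k ∸ 1) →
    SupermagicWithSum (Pk k G v) (Pk 2 G v)
    ((nV G + nE G) * ((nV G + nE G + 1) * k + 1) + ⌈ k /2⌉)
mainTheorem1 G _ v (suc (suc j)) (s≤s (s≤s z≤n)) _ exactly = blocks-cover , labelling , vertex-label< , magic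
  where
  open Covering G v j
  open PathOfCopies G v (suc j)
  open BlockIso G v (suc j) using (block-iso)
  open Labelling G v (suc j)
  magic : ∀ S → IsoTo Γ S (Pk 2 G v) → weight labelling S ≡ N * ((N + 1) * K + 1) + ⌈ K /2⌉
  magic S S≅P₂ with i , S~block ← exactly⇒exhausted exactly block block-iso block-distinct S S≅P₂ =
    trans (weight-cong labelling {S} {block i} S~block) (block-magic i)
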